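{- Let $(C_0, I, O)$ be an ILP Modulo $T$ instance and consider the $\mathrm{BC}(T)$ transition system for it. For any states $\langle P, A\rangle$ and $\langle P', A'\rangle$ with $\langle P, A\rangle \longrightarrow^* \langle P', A'\rangle$, $$\bigvee_{\langle C,D\rangle \in P'} (C \wedge D) \;\models_{\mathcal Z}\; \bigvee_{\langle C,D\rangle \in P} (C \wedge D).$$
   Context: Fix a set $\mathcal V$ of integer variables. An integer linear constraint has the form $c_1v_1+\dots+c_nv_n \bowtie r$ with integers $c_i, r$, $v_i \in \mathcal V$, $\bowtie \in \{<,\le,=,>,\ge\}$; an integer linear formula is a finite set (conjunction) of such constraints; an empty disjunction is false. An integer assignment is a function $A:\mathcal V\to\mathbb Z$, identified with the set of formulas $\{v = A(v) : v\in\mathcal V\}$. $\mathcal Z$ denotes the theory of linear integer arithmetic (all first-order sentences over the signature $0,\pm1,\pm2,\dots,+,-,\le$ true in the standard model $\mathbb Z$). For a theory $T'$, a formula $F$ is $T'$-consistent if $F\wedge T'$ has a model, and $F\models_{T'} G$ means $F\wedge\neg G$ is $T'$-inconsistent. Let $T$ be a $\Sigma$-theory with $\Sigma$ disjoint from the signature of $\mathcal Z$. A $\Sigma$-interface atom is a $\Sigma$-atomic formula $t$, possibly annotated with a variable $v$ (written $t^v$), the annotation meaning $t \Leftrightarrow v>0$. An ILP Modulo $T$ instance is a triple $(C_0, I, O)$ with $C_0$ an integer linear formula, $I$ a set of $\Sigma$-interface atoms, and $O=\sum_i c_i v_i$ an integer linear expression to be minimized. For an assignment $A$, $obj(A)=\sum_i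 c_iA(v_i)$; also $obj(\mathrm{none})=+\infty$ and $obj(A^{ -\infty})=-\infty$. An assignment $A$ is a $T$-model of a formula $F$ if $A$ is $T$-consistent and $A\models_{\mathcal Z\cup T} F$. A simple equality is a constraint $v_i=c$ or $v_i-v_j=c$ ($c$ an integer constant). A subproblem is a pair $\langle C, D\rangle$ with $C$ a set of integer linear constraints and $D$ a set of simple equalities. A state is a pair $\langle P, A\rangle$ where $P$ is a set of subproblems and $A$ is either the constant $\mathrm{none}$, an assignment, or an assignment annotated with superscript $-\infty$. A fixed function $lb$ on subproblems satisfies: no assignment $A$ satisfying $C\wedge D$ has $obj(A) < lb(\langle C,D\rangle)$. Notation: $P\uplus Q$ is union of disjoint sets; $C\,c$ is $C\cup\{c\}$ with $c\notin C$ (likewise $D\,d$). The transition relation $\longrightarrow$ of $\mathrm{BC}(T)$ is given by the rules: Branch: $\langle P\uplus\{\langle C,D\rangle\}, A\rangle \longrightarrow \langle P\cup\{\langle C_i,D\rangle : 1\le i\le n\}, A\rangle$ if $n>1$, $D\models_{\mathcal Z}(C\Leftrightarrow\bigvee_{i} C_i)$, and the $C_i$ are syntactically distinct. Learn: $\langle P\uplus\{\langle C,D\rangle\},A\rangle\longrightarrow\langle P\cup\{\langle C\,c,D\rangle\},A\rangle$ if $C\wedge D\models_{\mathcal Z} c$. Forget: $\langle P\uplus\{\langle C\,c,D\rangle\},A\rangle\longrightarrow\langle P\cup\{\langle C,D\rangle\},A\rangle$ if $C\wedge D\models_{\mathcal Z} c$. Propagate: $\langle P\uplus\{\langle C,D\rangle\},A\rangle\longrightarrow\langle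 P\cup\{\langle C,D\,d\rangle\},A\rangle$ if $d$ is a simple equality and $C\wedge D\models_{\mathcal Z} d$. Drop: $\langle P\uplus\{\langle C,D\rangle\},A\rangle\longrightarrow\langle P,A\rangle$ if $C\wedge D$ has no integer solution. Prune: $\langle P\uplus\{\langle C,D\rangle\},A\rangle\longrightarrow\langle P,A\rangle$ if $A\neq\mathrm{none}$ and $lb(\langle C,D\rangle)\ge obj(A)$. Retire: $\langle P\uplus\{\langle C,D\rangle\},A\rangle\longrightarrow\langle P,A'\rangle$ if $A'$ is a $T$-model of $C\wedge D\wedge I$, $obj(A')<obj(A)$, and $obj(A')\le obj(B)$ for every $T$-model $B$ of $C\wedge D\wedge I$. Unbounded: $\langle P\uplus\{\langle C,D\rangle\},A\rangle\longrightarrow\langle \emptyset,A'^{ -\infty}\rangle$ if $A'$ is a $T$-model of $C\wedge D\wedge I$, $obj(A')\le obj(A)$, and for every $k$ there is a $T$-model $B$ of $C\wedge D\wedge I$ with $obj(B)<k$. T-Learn: $\langle P\uplus\{\langle C,D\rangle\},A\rangle\longrightarrow\langle P\cup\{\langle C\,c,D\rangle\},A\rangle$ if there is a formula $F$ with $C\wedge D\models_{\mathcal Z} F$ and $F\wedge I\models_T c$. $S\longrightarrow^* S'$ means $S=S'$ or there is a finite nonempty chain of $\longrightarrow$ transitions from $S$ to $S'$. -}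

module Defs where

open import Data.Nat using (ℕ)
import Data.Nat as ℕ
open import Data.Integer using (ℤ; _+_; _*_; _<_; _≤_; _>_; _≥_; 0ℤ; 1ℤ; -1ℤ)
open import Data.List using (List; []; _∷_; _++_; map; length; foldr)
open import Data.List.Membership.Propositional using (_∈_)
open import Data.List.Relation.Unary.Any using (Any)
open import Data.List.Relation.Unary.All using (All)
open import Data.List.Relation.Unary.AllPairs using (AllPairs)
open import Data.Product using (_×_; _,_; Σ; ∃; ∃-syntax; proj₁; proj₂)
open import Data.Sum using (_⊎_)
open import Data.Maybe using (Maybe; just; nothing)
open import Relation.Nullary using (¬_)
open import Relation.Binary.PropositionalEquality using (_≡_; _≢_)
open import Relation.Binary.Construct.Closure.ReflexiveTransitive using (Star)

data Rel : Set where
  lt le eq gt ge : Rel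

LinExpr : Set → Set
LinExpr V = List (ℤ × V)          -- c₁v₁ + … + cₙvₙ

record Constraint (V : Set) : Set where
  constructor lin
  field
    terms : LinExpr V
    rel   : Rel
    rhs   : ℤ

Assignment : Set → Set
Assignment V = V → ℤ

evalE : {V : Set} → Assignment V → LinExpr V → ℤ
evalE α = foldr (λ cv acc → proj₁ cv * α (proj₂ cv) + acc) 0ℤ

relHolds : Rel → ℤ → ℤ → Set
relHolds lt x y = x < y
relHolds le x y = x ≤ y
relHolds eq x y = x ≡ y
relHolds gt x y = x > y
relHolds ge x y = x ≥ y

satC : {V : Set} → Assignment V → Constraint V → Set
satC α (lin ts r b) = relHolds r (evalE α ts) b

-- an integer linear formula = finite set (conjunction) of constraints
satF : {V : Set} → Assignment V → List (Constraint V) → Set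
satF α C = All (satC α) C

IsSimpleEq : {V : Set} → Constraint V → Set
IsSimpleEq {V} d =
  (Σ V λ v → Σ ℤ λ k → d ≡ lin ((1ℤ , v) ∷ []) eq k)
  ⊎ (Σ V λ vi → Σ V λ vj → Σ ℤ λ k → d ≡ lin ((1ℤ , vi) ∷ (-1ℤ , vj) ∷ []) eq k)

-- Finite sets represented by lists, modulo an element equivalence

MemBy : {A : Set} → (A → A → Set) → A → List A → Set
MemBy R x xs = Any (R x) xs

SetEqBy : {A : Set} → (A → A → Set) → List A → List A → Set
SetEqBy {A} R xs ys = (x : A) → (MemBy R x xs → MemBy R x ys) × (MemBy R x ys → MemBy R x xs)

SetEqC : {V : Set} → List (Constraint V) → List (Constraint V) → Set
SetEqC = SetEqBy _≡_

Extends : {V : Set} → List (Constraint V) → Constraint V → List (Constraint V) → Set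
Extends X x X' = ¬ (x ∈ X) × SetEqC X' (x ∷ X)

record Subproblem (V : Set) : Set where
  constructor ⟨_,_⟩
  field
    C : List (Constraint V)
    D : List (Constraint V)
open Subproblem public

satS : {V : Set} → Assignment V → Subproblem V → Set
satS α s = satF α (C s) × satF α (D s)

SubEq : {V : Set} → Subproblem V → Subproblem V → Set
SubEq s t = SetEqC (C s) (C t) × SetEqC (D s) (D t)

SetEqP : {V : Set} → List (Subproblem V) → List (Subproblem V) → Set
SetEqP = SetEqBy SubEq

Pick : {V : Set} → List (Subproblem V) → Subproblem V → List (Subproblem V) → Set
Pick P s Q = ¬ MemBy SubEq s Q × SetEqP P (s ∷ Q)

record Theory (V : Set) : Set₁ where
  field
    Atom   : Set
    Str    : Set
    Models : Assignment V → Str → Set              -- (α, M) is a model of T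
    holds  : Str → Assignment V → Atom → Set

module _ {V : Set} (Th : Theory V) where
  open Theory Th

  -- Σ-interface atom t or t^v
  IAtom : Set
  IAtom = Atom × Maybe V

  holdsI : Str → Assignment V → IAtom → Set
  holdsI M α (t , nothing) = holds M α t
  holdsI M α (t , just v)  = (holds M α t → 0ℤ < α v) × (0ℤ < α v → holds M α t)

record Instance {V : Set} (Th : Theory V) : Set where
  field
    C₀ : List (Constraint V)
    I  : List (IAtom Th)
    O  : LinExpr V
open Instance public

data ℤ∞ : Set where
  -∞  : ℤ∞
  fin : ℤ → ℤ∞
  +∞  : ℤ∞

data _≤∞_ : ℤ∞ → ℤ∞ → Set where
  -∞≤  : ∀ {x} → -∞ ≤∞ x
  fin≤ : ∀ {a b} → a ≤ b → fin a ≤∞ fin b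
  ≤+∞  : ∀ {x} → x ≤∞ +∞

data _<∞_ : ℤ∞ → ℤ∞ → Set where
  -∞<fin : ∀ {a} → -∞ <∞ fin a
  -∞<+∞  : -∞ <∞ +∞
  fin<   : ∀ {a b} → a < b → fin a <∞ fin b
  fin<+∞ : ∀ {a} → fin a <∞ +∞

data Incumbent (V : Set) : Set where
  none : Incumbent V
  asg  : Assignment V → Incumbent V
  unb  : Assignment V → Incumbent V

State : Set → Set
State V = List (Subproblem V) × Incumbent V

module BC {V : Set} {Th : Theory V} (inst : Instance Th) (lb : Subproblem V → ℤ∞) where
  open Theory Th

  obj : Assignment V → ℤ
  obj α = evalE α (O inst)

  objI : Incumbent V → ℤ∞
  objI none    = +∞
  objI (asg α) = fin (obj α)
  objI (unb α) = -∞

  AllI : Str → Assignment V → Set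
  AllI M α = All (holdsI Th M α) (I inst)

  TModelOf : (Assignment V → Set) → Assignment V → Set
  TModelOf F α = (∃ λ M → Models α M) × ((M : Str) → Models α M → F α × AllI M α)

  data Step : State V → State V → Set₁ where
    branch : ∀ {P P' A Q} {Cc Dd : List (Constraint V)} (Cs : List (List (Constraint V))) →
      Pick P ⟨ Cc , Dd ⟩ Q → 2 ℕ.≤ length Cs →
      ((α : Assignment V) → satF α Dd →
         (satF α Cc → Any (satF α) Cs) × (Any (satF α) Cs → satF α Cc)) →
      AllPairs (λ X Y → ¬ SetEqC X Y) Cs →
      SetEqP P' (map (λ Ci → ⟨ Ci , Dd ⟩) Cs ++ Q) →
      Step (P , A) (P' , A)
    learn : ∀ {P P' A Q Cc Cc' Dd} (c : Constraint V) →
      Pick P ⟨ Cc , Dd ⟩ Q → Extends Cc c Cc' →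
      ((α : Assignment V) → satF α Cc → satF α Dd → satC α c) →
      SetEqP P' (⟨ Cc' , Dd ⟩ ∷ Q) →
      Step (P , A) (P' , A)
    forget : ∀ {P P' A Q Cc Cc' Dd} (c : Constraint V) →
      Pick P ⟨ Cc' , Dd ⟩ Q → Extends Cc c Cc' →
      ((α : Assignment V) → satF α Cc → satF α Dd → satC α c) →
      SetEqP P' (⟨ Cc , Dd ⟩ ∷ Q) →
      Step (P , A) (P' , A)
    propagate : ∀ {P P' A Q Cc Dd Dd'} (d : Constraint V) →
      Pick P ⟨ Cc , Dd ⟩ Q → Extends Dd d Dd' → IsSimpleEq d →
      ((α : Assignment V) → satF α Cc → satF α Dd → satC α d) →
      SetEqP P' (⟨ Cc , Dd' ⟩ ∷ Q) →
      Step (P , A) (P' , A)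
    drop : ∀ {P P' A Q} (s : Subproblem V) →
      Pick P s Q → ((α : Assignment V) → ¬ satS α s) →
      SetEqP P' Q →
      Step (P , A) (P' , A)
    prune : ∀ {P P' A Q} (s : Subproblem V) →
      Pick P s Q → A ≢ none → objI A ≤∞ lb s →
      SetEqP P' Q →
      Step (P , A) (P' , A)
    retire : ∀ {P P' A Q} (s : Subproblem V) (A' : Assignment V) →
      Pick P s Q → TModelOf (λ β → satS β s) A' →
      fin (obj A') <∞ objI A →
      ((B : Assignment V) → TModelOf (λ β → satS β s) B → obj A' ≤ obj B) →
      SetEqP P' Q →
      Step (P , A) (P' , asg A')
    unbounded : ∀ {P A Q} (s : Subproblem V) (A' : Assignment V) →
      Pick P s Q → TModelOf (λ β → satS β s) A' →
      fin (obj A') ≤∞ objI A →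
      ((k : ℤ) → ∃ λ (B : Assignment V) → TModelOf (λ β → satS β s) B × obj B < k) →
      Step (P , A) ([] , unb A')
    tlearn : ∀ {P P' A Q Cc Cc' Dd} (c : Constraint V) →
      Pick P ⟨ Cc , Dd ⟩ Q → Extends Cc c Cc' →
      (∃ λ (F : Assignment V → Set) →
         ((α : Assignment V) → satF α Cc → satF α Dd → F α) ×
         ((α : Assignment V) (M : Str) → Models α M → F α → AllI M α → satC α c)) →
      SetEqP P' (⟨ Cc' , Dd ⟩ ∷ Q) →
      Step (P , A) (P' , A)

  Steps : State V → State V → Set₁
  Steps = Star Step

-- lb is a function on subproblems (pairs of sets), i.e. representation independent
LBWellDefined : {V : Set} → (Subproblem V → ℤ∞) → Set
LBWellDefined {V} lb = (s t : Subproblem V) → SubEq s t → lb s ≡ lb t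

LBSound : {V : Set} {Th : Theory V} → Instance Th → (Subproblem V → ℤ∞) → Set
LBSound {V} inst lb = (s : Subproblem V) (α : Assignment V) → satS α s → ¬ (fin (evalE α (O inst)) <∞ lb s)

EntailsZ : {V : Set} → List (Subproblem V) → List (Subproblem V) → Set
EntailsZ {V} P' P = (α : Assignment V) → Any (satS α) P' → Any (satS α) P

module Submission where

open import Defs
open import Data.List using (List; []; _∷_; _++_; map)
open import Data.List.Membership.Propositional using (find)
open import Data.List.Relation.Unary.All using (All; _∷_; lookup; tabulate)
open import Data.List.Relation.Unary.Any as Any using (Any; here; there)
open import Data.List.Relation.Unary.Any.Properties using (++⁻; map⁻)
open import Data.Product using (_,_; proj₁; proj₂; _×_)
open import Data.Sum using (_⊎_; inj₁; inj₂)
open import Relation.Binary.Definitions using (Reflexive; _Respects_)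
open import Relation.Binary.PropositionalEquality using (_≡_; refl)
open import Relation.Binary.Construct.Closure.ReflexiveTransitive using (ε; _◅_)
open import Function using (id)

module _ {A : Set} where

  SetEqBy-sym : {R : A → A → Set} {xs ys : List A} → SetEqBy R xs ys → SetEqBy R ys xs
  SetEqBy-sym e x = proj₂ (e x) , proj₁ (e x)

  All-resp-SetEq≡ : {P : A → Set} {xs ys : List A} → SetEqBy _≡_ xs ys → All P xs → All P ys
  All-resp-SetEq≡ e pxs = tabulate λ {y} y∈ys → lookup pxs (proj₂ (e y) y∈ys)

  Any-resp-SetEqBy : {R : A → A → Set} {P : A → Set} → Reflexive R → P Respects R →
                     {xs ys : List A} → SetEqBy R xs ys → Any P xs → Any P ys
  Any-resp-SetEqBy R-refl resp e pxs with find pxs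
  ... | x , x∈xs , px =
    Any.map (λ Rxy → resp Rxy px) (proj₁ (e x) (Any.map (λ { refl → R-refl }) x∈xs))

module _ {V : Set} {α : Assignment V} where

  satF-Extends⁻ : {X X' : List (Constraint V)} {c : Constraint V} →
                  Extends X c X' → satF α X' → satF α X
  satF-Extends⁻ (_ , e) sat with All-resp-SetEq≡ e sat
  ... | _ ∷ satX = satX

  satF-Extends⁺ : {X X' : List (Constraint V)} {c : Constraint V} →
                  Extends X c X' → satC α c → satF α X → satF α X'
  satF-Extends⁺ (_ , e) satc satX = All-resp-SetEq≡ (SetEqBy-sym e) (satc ∷ satX)

  SubEq-refl : Reflexive (SubEq {V})
  SubEq-refl = (λ _ → id , id) , (λ _ → id , id)

  satS-resp-SubEq : (λ s → satS α s) Respects SubEq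
  satS-resp-SubEq (eC , eD) (satC , satD) = All-resp-SetEq≡ eC satC , All-resp-SetEq≡ eD satD

  Any-satS-resp-SetEqP : {P Q : List (Subproblem V)} → SetEqP P Q →
                         Any (satS α) P → Any (satS α) Q
  Any-satS-resp-SetEqP = Any-resp-SetEqBy SubEq-refl satS-resp-SubEq

module _ {V : Set} where

  -- Every rule except Unbounded takes out one subproblem s and puts back
  -- subproblems R whose solutions all solve s (R = [] for Drop, Prune, Retire).
  EntailsZ-replace : {P P' Q R : List (Subproblem V)} {s : Subproblem V} →
                     Pick P s Q → SetEqP P' (R ++ Q) →
                     ((α : Assignment V) → Any (satS α) R → satS α s) →
                     EntailsZ P' P
  EntailsZ-replace {Q = Q} {R} {s} (_ , eP) eP' refines α solP' =
    Any-satS-resp-SetEqP (SetEqBy-sym eP) (solve-s∷Q (++⁻ R (Any-satS-resp-SetEqP eP' solP')))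
    where
      solve-s∷Q : Any (satS α) R ⊎ Any (satS α) Q → Any (satS α) (s ∷ Q)
      solve-s∷Q (inj₁ solR) = here (refines α solR)
      solve-s∷Q (inj₂ solQ) = there solQ

  single-refines : {s s' : Subproblem V} →
                   ((α : Assignment V) → satS α s' → satS α s) →
                   (α : Assignment V) → Any (satS α) (s' ∷ []) → satS α s
  single-refines refines α (here sat) = refines α sat

  branch-refines : {Cc Dd : List (Constraint V)} (Cs : List (List (Constraint V))) →
                   ((α : Assignment V) → satF α Dd → Any (satF α) Cs → satF α Cc) →
                   (α : Assignment V) → Any (satS α) (map (λ Ci → ⟨ Ci , Dd ⟩) Cs) →
                   satS α ⟨ Cc , Dd ⟩
  branch-refines Cs covers α solCs = covers α satD (Any.map proj₁ solCi) , satD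
    where
      solCi = map⁻ solCs
      satD = proj₂ (proj₂ (Any.satisfied solCi))

module _ {V : Set} {Th : Theory V} (inst : Instance Th) (lb : Subproblem V → ℤ∞) where
  open BC inst lb

  Step-EntailsZ : {S S' : State V} → Step S S' → EntailsZ (proj₁ S') (proj₁ S)
  Step-EntailsZ (branch Cs pick _ iff _ eP') =
    EntailsZ-replace pick eP' (branch-refines Cs λ α satD → proj₂ (iff α satD))
  Step-EntailsZ (learn _ pick ext _ eP') =
    EntailsZ-replace pick eP' (single-refines λ _ (satC , satD) → satF-Extends⁻ ext satC , satD)
  Step-EntailsZ (forget _ pick ext implied eP') =
    EntailsZ-replace pick eP'
      (single-refines λ α (satC , satD) → satF-Extends⁺ ext (implied α satC satD) satC , satD)
  Step-EntailsZ (propagate _ pick ext _ _ eP') =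
    EntailsZ-replace pick eP' (single-refines λ _ (satC , satD) → satC , satF-Extends⁻ ext satD)
  Step-EntailsZ (drop _ pick _ eP') = EntailsZ-replace pick eP' λ _ ()
  Step-EntailsZ (prune _ pick _ _ eP') = EntailsZ-replace pick eP' λ _ ()
  Step-EntailsZ (retire _ _ pick _ _ _ eP') = EntailsZ-replace pick eP' λ _ ()
  Step-EntailsZ (unbounded _ _ _ _ _ _) _ ()
  Step-EntailsZ (tlearn _ pick ext _ eP') =
    EntailsZ-replace pick eP' (single-refines λ _ (satC , satD) → satF-Extends⁻ ext satC , satD)

  Steps-EntailsZ : {S S' : State V} → Steps S S' → EntailsZ (proj₁ S') (proj₁ S)
  Steps-EntailsZ ε                α sol = sol
  Steps-EntailsZ (step ◅ steps) α sol = Step-EntailsZ step α (Steps-EntailsZ steps α sol)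

lemma6 : (V : Set) (Th : Theory V) (inst : Instance Th) (lb : Subproblem V → ℤ∞) →
         LBWellDefined lb → LBSound inst lb →
         (P P' : List (Subproblem V)) (A A' : Incumbent V) →
         BC.Steps inst lb (P , A) (P' , A') →
         EntailsZ P' P
lemma6 V Th inst lb _ _ P P' A A' steps = Steps-EntailsZ inst lb steps
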